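{- Let $S=\langle d_0,d_1,d_2,d_3\rangle$ be a numerical semigroup with embedding dimension four, and suppose $a_{ii}=b_{ii}$ for at least two distinct indices $i\in\{1,2,3\}$. Let $R$ be the collection of all cubes of the initial collection whose labels lie in $\mathrm{Ap}(S,d_0)$. Delete from $R$ every cube $[[i,j,k]]$ with $i\ge a_{11}$, every cube with $j\ge a_{22}$, and every cube with $k\ge a_{33}$. Then each element of $\mathrm{Ap}(S,d_0)$ labels exactly one cube of the resulting collection.
   Context: $S=\langle d_0,\dots,d_3\rangle$ is the set of nonnegative integer combinations of its minimal generators $d_0,\dots,d_3$ (with $\gcd=1$). $\mathrm{Ap}(S,d_0)=\{s\in S:s-d_0\notin S\}$. For $(i,j,k)\in\mathbb N^3$ the cube $[[i,j,k]]=[i,i+1]\times[j,j+1]\times[k,k+1]$ is labeled $id_1+jd_2+kd_3$; the initial collection is the set of all these cubes. For $i\in\{1,2,3\}$: $a_{ii}$ is the least positive integer such that $a_{ii}d_i=\sum_{j\neq i}a_{ij}d_j$ with all $a_{ij}\in\mathbb N$ (minimal relation), and $b_{ii}$ is the least positive integer such that $b_{ii}d_i=\sum_{j\ne i}b_{ij}d_j$ with all $b_{ij}\in\mathbb N$ and $b_{i0}>0$ ($d_0$-positive minimal relation). (By a result of the paper, $R$ equals the collection obtained from the initial collection by deleting the regions $\{x\ge a,y\ge b,z\ge c\}$ associated to explicit relation points.) -}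

module Defs where

open import Data.Nat using (ℕ; zero; suc; _+_; _*_; _<_)
open import Data.Nat.GCD using (gcd)
open import Data.Fin using (Fin; zero; suc)
open import Data.Product using (Σ; _×_; _,_)
open import Relation.Binary.PropositionalEquality using (_≡_)
open import Relation.Nullary using (¬_)

Gens : Set
Gens = Fin 4 → ℕ

i0 i1 i2 i3 : Fin 4
i0 = zero
i1 = suc zero
i2 = suc (suc zero)
i3 = suc (suc (suc zero))

comb : Gens → (Fin 4 → ℕ) → ℕ
comb d c = c i0 * d i0 + c i1 * d i1 + c i2 * d i2 + c i3 * d i3

InS : Gens → ℕ → Set
InS d s = Σ (Fin 4 → ℕ) λ c → s ≡ comb d c

-- Apéry set Ap(S,d₀) = {s ∈ S : s - d₀ ∉ S} (integer subtraction: s - d₀ ∈ S iff s = t + d₀ with t ∈ S)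
InAp : Gens → ℕ → Set
InAp d w = InS d w × ¬ (Σ ℕ λ t → InS d t × t + d i0 ≡ w)

IsEmbDim4 : Gens → Set
IsEmbDim4 d =
  (∀ i → 0 < d i) ×
  (gcd (gcd (d i0) (d i1)) (gcd (d i2) (d i3)) ≡ 1) ×
  (∀ i → ¬ (Σ (Fin 4 → ℕ) λ c → c i ≡ 0 × d i ≡ comb d c))

Rel : Gens → Fin 4 → ℕ → Set
Rel d i a = Σ (Fin 4 → ℕ) λ c → c i ≡ 0 × a * d i ≡ comb d c

PosRel : Gens → Fin 4 → ℕ → Set
PosRel d i a = Σ (Fin 4 → ℕ) λ c → c i ≡ 0 × 0 < c i0 × a * d i ≡ comb d c

IsLeastPos : (ℕ → Set) → ℕ → Set
IsLeastPos P a = 0 < a × P a × (∀ a' → 0 < a' → a' < a → ¬ P a')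

label : Gens → ℕ → ℕ → ℕ → ℕ
label d i j k = i * d i1 + j * d i2 + k * d i3

-- Every representation w = Σ cᵢdᵢ of an Apéry element has c₀ = 0, and if a_mm = b_mm it also
-- has c_m < a_mm: otherwise trading a_mm·d_m for the d₀-positive relation would give a
-- representation with c₀ > 0.  When this holds for two indices, reducing the third coefficient
-- by its minimal relation (which never increases the other two past their bounds, since they are
-- forced) produces a representation inside the box.  Uniqueness holds in the box for any S:
-- two box representations of the same element cancel to a relation between disjoint supports,
-- and one side of such a relation is supported on a single generator, so it is either trivial or
-- a relation n·d_m = … with 0 < n < a_mm, contradicting minimality.
module Submission where

open import Defs
open import Data.Nat using (ℕ; zero; suc; _+_; _*_; _∸_; _<_; _≤_; z≤n; z<s; >-nonZero)
open import Data.Nat.Properties hiding (_≟_)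
open import Data.Nat.Tactic.RingSolver using (solve-∀)
open import Data.Fin using (Fin; zero; suc)
open import Data.Fin.Properties using (_≟_)
open import Data.Vec.Functional using (Vector; zipWith; updateAt)
open import Data.Vec.Functional.Properties using (updateAt-updates; updateAt-minimal)
open import Data.Vec.Functional.Relation.Binary.Pointwise using (Pointwise)
open import Data.Product using (Σ; _×_; _,_; proj₁)
open import Data.Sum using (_⊎_; inj₁; inj₂)
open import Relation.Nullary using (yes; no; contradiction)
open import Relation.Binary.PropositionalEquality

private
  variable
    m : Fin 4
    a b w : ℕ
    u v : Vector ℕ 4
    i j k i' j' k' : ℕ

single : Fin 4 → ℕ → Vector ℕ 4
single m a = updateAt (λ _ → 0) m (λ _ → a)

single-≤ : a ≤ v m → Pointwise _≤_ (single m a) v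
single-≤ {m = m} a≤vm i with i ≟ m
... | yes refl = subst (_≤ _) (sym (updateAt-updates m (λ _ → 0))) a≤vm
... | no i≢m = subst (_≤ _) (sym (updateAt-minimal i m (λ _ → 0) i≢m)) z≤n

m+[n∸m]≡n+[m∸n] : ∀ m n → m + (n ∸ m) ≡ n + (m ∸ n)
m+[n∸m]≡n+[m∸n] m n with ≤-total m n
... | inj₁ m≤n = trans (m+[n∸m]≡n m≤n) (sym (trans (cong (n +_) (m≤n⇒m∸n≡0 m≤n)) (+-identityʳ n)))
... | inj₂ n≤m = sym (trans (m+[n∸m]≡n n≤m) (sym (trans (cong (m +_) (m≤n⇒m∸n≡0 n≤m)) (+-identityʳ m))))

cubeCoeffs : ℕ → ℕ → ℕ → Vector ℕ 4
cubeCoeffs i j k zero = 0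
cubeCoeffs i j k (suc zero) = i
cubeCoeffs i j k (suc (suc zero)) = j
cubeCoeffs i j k (suc (suc (suc zero))) = k

cube-≤-off₁ : j ≤ j' → k ≤ k' → ∀ l → l ≢ i1 → cubeCoeffs i j k l ≤ cubeCoeffs i' j' k' l
cube-≤-off₁ _ _ zero _ = z≤n
cube-≤-off₁ _ _ (suc zero) l≢1 = contradiction refl l≢1
cube-≤-off₁ j≤j' _ (suc (suc zero)) _ = j≤j'
cube-≤-off₁ _ k≤k' (suc (suc (suc zero))) _ = k≤k'

cube-≤-off₂ : i ≤ i' → k ≤ k' → ∀ l → l ≢ i2 → cubeCoeffs i j k l ≤ cubeCoeffs i' j' k' l
cube-≤-off₂ _ _ zero _ = z≤n
cube-≤-off₂ i≤i' _ (suc zero) _ = i≤i'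
cube-≤-off₂ _ _ (suc (suc zero)) l≢2 = contradiction refl l≢2
cube-≤-off₂ _ k≤k' (suc (suc (suc zero))) _ = k≤k'

cube-≤-off₃ : i ≤ i' → j ≤ j' → ∀ l → l ≢ i3 → cubeCoeffs i j k l ≤ cubeCoeffs i' j' k' l
cube-≤-off₃ _ _ zero _ = z≤n
cube-≤-off₃ i≤i' _ (suc zero) _ = i≤i'
cube-≤-off₃ _ j≤j' (suc (suc zero)) _ = j≤j'
cube-≤-off₃ _ _ (suc (suc (suc zero))) l≢3 = contradiction refl l≢3

module _ (d : Gens) where

  comb-cong : u ≗ v → comb d u ≡ comb d v
  comb-cong u≗v rewrite u≗v i0 | u≗v i1 | u≗v i2 | u≗v i3 = refl

  comb-+ : ∀ u v → comb d (zipWith _+_ u v) ≡ comb d u + comb d v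
  comb-+ u v = distrib (u i0) (u i1) (u i2) (u i3) (v i0) (v i1) (v i2) (v i3) (d i0) (d i1) (d i2) (d i3)
    where
    distrib : ∀ a b c x p q r s D₀ D₁ D₂ D₃ →
      (a + p) * D₀ + (b + q) * D₁ + (c + r) * D₂ + (x + s) * D₃
      ≡ (a * D₀ + b * D₁ + c * D₂ + x * D₃) + (p * D₀ + q * D₁ + r * D₂ + s * D₃)
    distrib = solve-∀

  comb-single : ∀ m a → comb d (single m a) ≡ a * d m
  comb-single zero a = trans (+-identityʳ _) (trans (+-identityʳ _) (+-identityʳ _))
  comb-single (suc zero) a = trans (+-identityʳ _) (+-identityʳ _)
  comb-single (suc (suc zero)) a = +-identityʳ _
  comb-single (suc (suc (suc zero))) a = refl

  comb-supported : ∀ m (c : Vector ℕ 4) → (∀ i → i ≢ m → c i ≡ 0) → comb d c ≡ c m * d m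
  comb-supported m c off = trans (comb-cong c≗single) (comb-single m (c m))
    where
    c≗single : c ≗ single m (c m)
    c≗single i with i ≟ m
    ... | yes refl = sym (updateAt-updates m (λ _ → 0))
    ... | no i≢m = trans (off i i≢m) (sym (updateAt-minimal i m (λ _ → 0) i≢m))

  comb-∸ : ∀ u v → Pointwise _≤_ u v → comb d v ≡ comb d (zipWith _∸_ v u) + comb d u
  comb-∸ u v u≤v = trans (comb-cong (λ i → sym (m∸n+n≡m (u≤v i)))) (comb-+ (zipWith _∸_ v u) u)

  comb-split : ∀ v m → a ≤ v m → comb d v ≡ comb d (zipWith _∸_ v (single m a)) + a * d m
  comb-split {a} v m a≤vm =
    trans (comb-∸ (single m a) v (single-≤ a≤vm))
          (cong (comb d (zipWith _∸_ v (single m a)) +_) (comb-single m a))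

  comb-cancel : ∀ u v → comb d u ≡ comb d v → comb d (zipWith _∸_ u v) ≡ comb d (zipWith _∸_ v u)
  comb-cancel u v eq = +-cancelˡ-≡ (comb d v) _ _ (begin
    comb d v + comb d (zipWith _∸_ u v)   ≡⟨ comb-+ v (zipWith _∸_ u v) ⟨
    comb d (zipWith _+_ v (zipWith _∸_ u v)) ≡⟨ comb-cong (λ i → m+[n∸m]≡n+[m∸n] (v i) (u i)) ⟩
    comb d (zipWith _+_ u (zipWith _∸_ v u)) ≡⟨ comb-+ u (zipWith _∸_ v u) ⟩
    comb d u + comb d (zipWith _∸_ v u)   ≡⟨ cong (_+ comb d (zipWith _∸_ v u)) eq ⟩
    comb d v + comb d (zipWith _∸_ v u)   ∎)
    where open ≡-Reasoning

  comb≡0 : (∀ i → 0 < d i) → ∀ c → comb d c ≡ 0 → ∀ i → c i ≡ 0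
  comb≡0 pos c s i = m*n≡0⇒m≡0 (c i) (d i) {{>-nonZero (pos i)}} (term≡0 i)
    where
    s₃ : c i0 * d i0 + c i1 * d i1 + c i2 * d i2 ≡ 0
    s₃ = m+n≡0⇒m≡0 _ s
    s₂ : c i0 * d i0 + c i1 * d i1 ≡ 0
    s₂ = m+n≡0⇒m≡0 _ s₃
    term≡0 : ∀ i → c i * d i ≡ 0
    term≡0 zero = m+n≡0⇒m≡0 _ s₂
    term≡0 (suc zero) = m+n≡0⇒n≡0 _ s₂
    term≡0 (suc (suc zero)) = m+n≡0⇒n≡0 _ s₃
    term≡0 (suc (suc (suc zero))) = m+n≡0⇒n≡0 _ s

  trade : Fin 4 → ℕ → Vector ℕ 4 → Vector ℕ 4 → Vector ℕ 4
  trade m a c v = zipWith _+_ (zipWith _∸_ v (single m a)) c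

  comb-trade : ∀ v m c → a ≤ v m → a * d m ≡ comb d c → comb d (trade m a c v) ≡ comb d v
  comb-trade {a} v m c a≤vm rel = begin
    comb d (trade m a c v)                          ≡⟨ comb-+ (zipWith _∸_ v (single m a)) c ⟩
    comb d (zipWith _∸_ v (single m a)) + comb d c ≡⟨ cong (comb d (zipWith _∸_ v (single m a)) +_) rel ⟨
    comb d (zipWith _∸_ v (single m a)) + a * d m  ≡⟨ comb-split v m a≤vm ⟨
    comb d v                                        ∎
    where open ≡-Reasoning

  Ap-coeff₀≡0 : InAp d w → ∀ v → w ≡ comb d v → v i0 ≡ 0
  Ap-coeff₀≡0 {w} (_ , w-d₀∉S) v w≡v =
    n≤0⇒n≡0 (≮⇒≥ λ 0<v₀ → w-d₀∉S (comb d v' , (v' , refl) , v'+d₀≡w 0<v₀))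
    where
    v' : Vector ℕ 4
    v' = zipWith _∸_ v (single i0 1)
    v'+d₀≡w : 1 ≤ v i0 → comb d v' + d i0 ≡ w
    v'+d₀≡w 1≤v₀ = sym (trans w≡v (trans (comb-split v i0 1≤v₀) (cong (comb d v' +_) (*-identityˡ (d i0)))))

  Ap-coeff<PosRel : InAp d w → ∀ v → w ≡ comb d v → PosRel d m b → v m < b
  Ap-coeff<PosRel {w} {m} {b} w∈Ap v w≡v (c , _ , 0<c₀ , rel) with v m <? b
  ... | yes vm<b = vm<b
  ... | no vm≮b = contradiction (Ap-coeff₀≡0 w∈Ap (trade m b c v) w≡trade) (>⇒≢ trade₀>0)
    where
    w≡trade : w ≡ comb d (trade m b c v)
    w≡trade = trans w≡v (sym (comb-trade v m c (≮⇒≥ vm≮b) rel))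
    trade₀>0 : 0 < trade m b c v i0
    trade₀>0 = <-≤-trans 0<c₀ (m≤n+m (c i0) _)

  reduce-coeff : 0 < a → Rel d m a → InS d w → Σ (Vector ℕ 4) λ u → w ≡ comb d u × u m < a
  reduce-coeff {a} {m} {w} 0<a (c , cₘ≡0 , rel) (v , w≡v) = go (suc (v m)) v w≡v ≤-refl
    where
    trade-decreases : ∀ v → a ≤ v m → trade m a c v m < v m
    trade-decreases v a≤vm
      rewrite updateAt-updates m {λ _ → a} (λ _ → 0) | cₘ≡0 | +-identityʳ (v m ∸ a) = ∸-monoʳ-< 0<a a≤vm
    go : ∀ n v → w ≡ comb d v → v m < n → Σ (Vector ℕ 4) λ u → w ≡ comb d u × u m < a
    go (suc n) v w≡v vm<n with v m <? a
    ... | yes vm<a = v , w≡v , vm<a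
    ... | no vm≮a = go n (trade m a c v) (trans w≡v (sym (comb-trade v m c a≤vm rel)))
                       (<-≤-trans (trade-decreases v a≤vm) (≤-pred vm<n))
      where a≤vm = ≮⇒≥ vm≮a

  comb-≡-dominated : (∀ i → 0 < d i) → Pointwise _≤_ u v → comb d u ≡ comb d v → u ≗ v
  comb-≡-dominated {u} {v} pos u≤v eq i =
    ≤-antisym (u≤v i) (m∸n≡0⇒m≤n (comb≡0 pos (zipWith _∸_ v u) excess≡0 i))
    where
    excess≡0 : comb d (zipWith _∸_ v u) ≡ 0
    excess≡0 = +-cancelʳ-≡ (comb d u) _ 0 (trans (sym (comb-∸ u v u≤v)) (sym eq))

  comb-≡-dominated-off : (∀ i → 0 < d i) → IsLeastPos (Rel d m) a → u m < a →
    (∀ i → i ≢ m → u i ≤ v i) → comb d u ≡ comb d v → u ≗ v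
  comb-≡-dominated-off {m} {a} {u} {v} pos (_ , _ , least) um<a off eq = by-excess (u m ∸ v m) refl
    where
    rel : (u m ∸ v m) * d m ≡ comb d (zipWith _∸_ v u)
    rel = trans (sym (comb-supported m (zipWith _∸_ u v) λ i i≢m → m≤n⇒m∸n≡0 (off i i≢m)))
                (comb-cancel u v eq)
    by-excess : ∀ x → u m ∸ v m ≡ x → u ≗ v
    by-excess zero um∸vm≡0 = comb-≡-dominated pos u≤v eq
      where
      u≤v : Pointwise _≤_ u v
      u≤v i with i ≟ m
      ... | yes refl = m∸n≡0⇒m≤n um∸vm≡0
      ... | no i≢m = off i i≢m
    by-excess (suc n) um∸vm≡1+n = contradiction relation (least (suc n) z<s 1+n<a)
      where
      vm≤um : v m ≤ u m
      vm≤um = <⇒≤ (m∸n≢0⇒n<m λ um∸vm≡0 → 0≢1+n (trans (sym um∸vm≡0) um∸vm≡1+n))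
      relation : Rel d m (suc n)
      relation = zipWith _∸_ v u , m≤n⇒m∸n≡0 vm≤um ,
                 subst (λ x → x * d m ≡ comb d (zipWith _∸_ v u)) um∸vm≡1+n rel
      1+n<a : suc n < a
      1+n<a = ≤-<-trans (subst (_≤ u m) um∸vm≡1+n (m∸n≤m (u m) (v m))) um<a

  label-injective-in-box : (∀ i → 0 < d i) → ∀ {a₁ a₂ a₃} →
    IsLeastPos (Rel d i1) a₁ → IsLeastPos (Rel d i2) a₂ → IsLeastPos (Rel d i3) a₃ →
    ∀ i j k i' j' k' → i < a₁ → j < a₂ → k < a₃ → i' < a₁ → j' < a₂ → k' < a₃ →
    label d i j k ≡ label d i' j' k' → (i , j , k) ≡ (i' , j' , k')
  label-injective-in-box pos la₁ la₂ la₃ i j k i' j' k' i<a₁ j<a₂ k<a₃ i'<a₁ j'<a₂ k'<a₃ eq =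
    cong₂ _,_ (coeffs≗ i1) (cong₂ _,_ (coeffs≗ i2) (coeffs≗ i3))
    where
    flip≗ : cubeCoeffs i' j' k' ≗ cubeCoeffs i j k → cubeCoeffs i j k ≗ cubeCoeffs i' j' k'
    flip≗ eq' l = sym (eq' l)
    -- One triple dominates the other in every coordinate except at most one.
    coeffs≗ : cubeCoeffs i j k ≗ cubeCoeffs i' j' k'
    coeffs≗ with ≤-total j j' | ≤-total k k' | ≤-total i i'
    ... | inj₁ j≤j' | inj₁ k≤k' | _ = comb-≡-dominated-off pos la₁ i<a₁ (cube-≤-off₁ j≤j' k≤k') eq
    ... | inj₂ j'≤j | inj₂ k'≤k | _ = flip≗ (comb-≡-dominated-off pos la₁ i'<a₁ (cube-≤-off₁ j'≤j k'≤k) (sym eq))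
    ... | inj₁ j≤j' | inj₂ k'≤k | inj₁ i≤i' = comb-≡-dominated-off pos la₃ k<a₃ (cube-≤-off₃ i≤i' j≤j') eq
    ... | inj₁ j≤j' | inj₂ k'≤k | inj₂ i'≤i = flip≗ (comb-≡-dominated-off pos la₂ j'<a₂ (cube-≤-off₂ i'≤i k'≤k) (sym eq))
    ... | inj₂ j'≤j | inj₁ k≤k' | inj₁ i≤i' = comb-≡-dominated-off pos la₂ j<a₂ (cube-≤-off₂ i≤i' k≤k') eq
    ... | inj₂ j'≤j | inj₁ k≤k' | inj₂ i'≤i = flip≗ (comb-≡-dominated-off pos la₃ k'<a₃ (cube-≤-off₃ i'≤i j'≤j) (sym eq))

  comb≡label : ∀ u → u i0 ≡ 0 → comb d u ≡ label d (u i1) (u i2) (u i3)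
  comb≡label u u₀≡0 rewrite u₀≡0 = refl

  Ap-in-box : ∀ {a₁ a₂ a₃ b₁ b₂ b₃} →
    IsLeastPos (Rel d i1) a₁ → IsLeastPos (Rel d i2) a₂ → IsLeastPos (Rel d i3) a₃ →
    PosRel d i1 b₁ → PosRel d i2 b₂ → PosRel d i3 b₃ →
    (a₁ ≡ b₁ × a₂ ≡ b₂) ⊎ (a₁ ≡ b₁ × a₃ ≡ b₃) ⊎ (a₂ ≡ b₂ × a₃ ≡ b₃) →
    InAp d w → Σ (Vector ℕ 4) λ u → w ≡ comb d u × u i1 < a₁ × u i2 < a₂ × u i3 < a₃
  Ap-in-box _ _ (0<a₃ , ρ₃ , _) r₁ r₂ r₃ (inj₁ (refl , refl)) w∈Ap =
    let u , w≡u , u₃<a₃ = reduce-coeff 0<a₃ ρ₃ (proj₁ w∈Ap) in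
    u , w≡u , Ap-coeff<PosRel w∈Ap u w≡u r₁ , Ap-coeff<PosRel w∈Ap u w≡u r₂ , u₃<a₃
  Ap-in-box _ (0<a₂ , ρ₂ , _) _ r₁ r₂ r₃ (inj₂ (inj₁ (refl , refl))) w∈Ap =
    let u , w≡u , u₂<a₂ = reduce-coeff 0<a₂ ρ₂ (proj₁ w∈Ap) in
    u , w≡u , Ap-coeff<PosRel w∈Ap u w≡u r₁ , u₂<a₂ , Ap-coeff<PosRel w∈Ap u w≡u r₃
  Ap-in-box (0<a₁ , ρ₁ , _) _ _ r₁ r₂ r₃ (inj₂ (inj₂ (refl , refl))) w∈Ap =
    let u , w≡u , u₁<a₁ = reduce-coeff 0<a₁ ρ₁ (proj₁ w∈Ap) in
    u , w≡u , u₁<a₁ , Ap-coeff<PosRel w∈Ap u w≡u r₂ , Ap-coeff<PosRel w∈Ap u w≡u r₃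

proposition2p5 : (d : Gens) → IsEmbDim4 d →
    (a₁₁ a₂₂ a₃₃ b₁₁ b₂₂ b₃₃ : ℕ) →
    IsLeastPos (Rel d i1) a₁₁ → IsLeastPos (Rel d i2) a₂₂ → IsLeastPos (Rel d i3) a₃₃ →
    IsLeastPos (PosRel d i1) b₁₁ → IsLeastPos (PosRel d i2) b₂₂ → IsLeastPos (PosRel d i3) b₃₃ →
    ((a₁₁ ≡ b₁₁ × a₂₂ ≡ b₂₂) ⊎ (a₁₁ ≡ b₁₁ × a₃₃ ≡ b₃₃) ⊎ (a₂₂ ≡ b₂₂ × a₃₃ ≡ b₃₃)) →
    ∀ w → InAp d w →
    Σ (ℕ × ℕ × ℕ) λ { (i , j , k) →
      (InAp d (label d i j k) × i < a₁₁ × j < a₂₂ × k < a₃₃ × label d i j k ≡ w) ×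
      (∀ i' j' k' → InAp d (label d i' j' k') → i' < a₁₁ → j' < a₂₂ → k' < a₃₃ →
        label d i' j' k' ≡ w → (i' , j' , k') ≡ (i , j , k)) }
proposition2p5 d (pos , _ , _) _ _ _ _ _ _ la₁ la₂ la₃ (_ , r₁ , _) (_ , r₂ , _) (_ , r₃ , _) two-equal w w∈Ap
  with Ap-in-box d la₁ la₂ la₃ r₁ r₂ r₃ two-equal w∈Ap
... | u , w≡u , u₁<a₁ , u₂<a₂ , u₃<a₃ =
  (u i1 , u i2 , u i3) , (subst (InAp d) (sym label≡w) w∈Ap , u₁<a₁ , u₂<a₂ , u₃<a₃ , label≡w) ,
  λ i' j' k' _ i'<a₁ j'<a₂ k'<a₃ label'≡w →
    label-injective-in-box d pos la₁ la₂ la₃ i' j' k' (u i1) (u i2) (u i3)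
      i'<a₁ j'<a₂ k'<a₃ u₁<a₁ u₂<a₂ u₃<a₃ (trans label'≡w (sym label≡w))
  where
  label≡w : label d (u i1) (u i2) (u i3) ≡ w
  label≡w = sym (trans w≡u (comb≡label d u (Ap-coeff₀≡0 d w∈Ap u w≡u)))
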